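{- Let $n\ge1$, let $\pi\in S_n$ avoid the classical pattern $312$, and let $i\in[n]$. Writing $p=\mathrm{plmax}(\pi,i)$, we have $$\mathrm{inv}(\pi,i)=\mathrm{inv}(\pi,p)-(i-p).$$
   Context: $S_n$ is the set of permutations of $[n]$ in one-line notation. $\pi$ avoids $312$ if there are no indices $a<b<c$ with $\pi_b<\pi_c<\pi_a$. A position $j$ is a left-to-right maximum of $\pi$ if $\pi_j>\pi_l$ for all $l<j$; $\mathrm{Lmax}(\pi)$ is the set of such positions (it always contains $1$). $\mathrm{plmax}(\pi,i)=\max\{j\in\mathrm{Lmax}(\pi): j\le i\}$. $\mathrm{inv}(\pi,i)$ is the number of $j$ with $i<j\le n$ and $\pi_i>\pi_j$. -}

module Defs where

open import Data.Nat using (ℕ; suc)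
open import Data.Fin using (Fin; toℕ; _<_; _≤_)
open import Data.Fin.Properties using (_<?_)
open import Data.Vec.Functional using (Vector)
open import Data.List using (List; filter; length)
open import Data.List using () renaming (allFin to allFinL)
open import Data.Product using (_×_)
open import Function.Bundles using (_↔_; Inverse)
open import Relation.Nullary using (¬_)
open import Relation.Nullary.Decidable using (_×-dec_)

-- Permutations of [n], positions and values 0-indexed via Fin n
-- (position j ↦ value π j).  A permutation is a bijection Fin n ↔ Fin n.
Perm : ℕ → Set
Perm n = Fin n ↔ Fin n

_⟨_⟩ : ∀ {n} → Perm n → Fin n → Fin n
π ⟨ j ⟩ = Inverse.to π j

Avoids312 : ∀ {n} → Perm n → Set
Avoids312 {n} π = (a b c : Fin n) → a < b → b < c →
  ¬ ((π ⟨ b ⟩ < π ⟨ c ⟩) × (π ⟨ c ⟩ < π ⟨ a ⟩))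

IsLmax : ∀ {n} → Perm n → Fin n → Set
IsLmax {n} π j = (l : Fin n) → l < j → π ⟨ l ⟩ < π ⟨ j ⟩

IsPlmax : ∀ {n} → Perm n → Fin n → Fin n → Set
IsPlmax {n} π i p = IsLmax π p × p ≤ i ×
  ((j : Fin n) → IsLmax π j → j ≤ i → j ≤ p)

inv : ∀ {n} → Perm n → Fin n → ℕ
inv {n} π i = length (filter (λ j → (i <? j) ×-dec (π ⟨ j ⟩ <? π ⟨ i ⟩)) (allFinL n))

{-# OPTIONS --safe #-}
-- Every position k in (p, i] has π_k < π_p: otherwise, inductively along (p, i], k would be a
-- left-to-right maximum after p and no later than i.  So the inversions (p, x) are the i − p
-- positions of (p, i] together with the x > i having π_x < π_p, and for those π_x < π_i, since
-- π_i < π_x < π_p would make (p, i, x) an occurrence of 312.  These are exactly the inversions of i.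
module Submission where

open import Defs
open import Data.Nat using (ℕ; suc; _≥_)
open import Data.Fin using (Fin; toℕ)
open import Data.Integer using (ℤ; +_; _-_)
open import Relation.Binary.PropositionalEquality using (_≡_)

import Data.Nat as ℕ
import Data.Nat.Properties as ℕ
import Data.Fin as Fin
open import Data.Fin using (zero; suc; _<_; _≤_)
open import Data.Fin.Induction using (<-wellFounded)
open import Data.Fin.Properties using (_<?_; _≤?_; _≟_; <-cmp; ≤∧≢⇒<)
import Data.Integer as ℤ
open import Data.Integer.Properties using (pos-+)
open import Data.Integer.Tactic.RingSolver using (solve-∀)
open import Data.List using (List; []; _∷_; filter; length; map; tabulate; allFin)
open import Data.List.Properties using (length-map; map-tabulate; filter-none; filter-≐)
open import Data.List.Relation.Unary.All.Properties using (tabulate⁺)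
open import Data.Product using (_×_; _,_; proj₁; proj₂)
open import Data.Sum using (_⊎_; inj₁; inj₂; [_,_])
open import Function using (_∘_; id)
open import Function.Bundles using (Injection)
open import Function.Properties.Inverse using (Inverse⇒Injection)
open import Induction.WellFounded using (Acc; acc)
open import Level using (0ℓ)
open import Relation.Binary.Definitions using (tri<; tri≈; tri>)
open import Relation.Binary.PropositionalEquality using (refl; sym; trans; cong; cong₂; module ≡-Reasoning)
open import Relation.Nullary using (yes; no; contradiction)
open import Relation.Nullary.Decidable using (_×-dec_)
open import Relation.Unary using (Pred; Decidable; _≐_; _∪_; _⊥_)

module _ {A : Set} {P Q R : Pred A 0ℓ} (P? : Decidable P) (Q? : Decidable Q) (R? : Decidable R)
         (P≐Q∪R : P ≐ Q ∪ R) (Q⊥R : Q ⊥ R) where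

  length-filter-∪ : (xs : List A) →
    length (filter P? xs) ≡ length (filter Q? xs) ℕ.+ length (filter R? xs)
  length-filter-∪ [] = refl
  length-filter-∪ (x ∷ xs) with P? x | Q? x | R? x
  ... | _      | yes qx | yes rx = contradiction (qx , rx) Q⊥R
  ... | yes _  | yes _  | no _   = cong suc (length-filter-∪ xs)
  ... | yes _  | no _   | yes _  = trans (cong suc (length-filter-∪ xs)) (sym (ℕ.+-suc _ _))
  ... | yes px | no ¬qx | no ¬rx with proj₁ P≐Q∪R px
  ...   | inj₁ qx = contradiction qx ¬qx
  ...   | inj₂ rx = contradiction rx ¬rx
  length-filter-∪ (x ∷ xs) | no ¬px | yes qx | _      = contradiction (proj₂ P≐Q∪R (inj₁ qx)) ¬px
  length-filter-∪ (x ∷ xs) | no ¬px | no _   | yes rx = contradiction (proj₂ P≐Q∪R (inj₂ rx)) ¬px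
  length-filter-∪ (x ∷ xs) | no _   | no _   | no _   = length-filter-∪ xs

filter-map : {A B : Set} {P : Pred B 0ℓ} (P? : Decidable P) (f : A → B) (xs : List A) →
  filter P? (map f xs) ≡ map f (filter (P? ∘ f) xs)
filter-map P? f [] = refl
filter-map P? f (x ∷ xs) with P? (f x)
... | yes _ = cong (f x ∷_) (filter-map P? f xs)
... | no _  = filter-map P? f xs

length-filter-≤-allFin : ∀ {n} (i : Fin n) → length (filter (_≤? i) (allFin n)) ≡ suc (toℕ i)
length-filter-≤-allFin {suc n} zero =
  cong (suc ∘ length) (filter-none (_≤? zero {n}) (tabulate⁺ {f = Fin.suc {n}} λ _ ()))
length-filter-≤-allFin {suc n} (suc i) = cong suc (begin
  length (filter (_≤? suc i) (tabulate (Fin.suc {n})))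
    ≡⟨ cong (length ∘ filter (_≤? suc i)) (sym (map-tabulate {n = n} id Fin.suc)) ⟩
  length (filter (_≤? suc i) (map Fin.suc (allFin n)))
    ≡⟨ cong length (filter-map (_≤? suc i) Fin.suc (allFin n)) ⟩
  length (map Fin.suc (filter (λ j → suc j ≤? suc i) (allFin n)))
    ≡⟨ length-map Fin.suc (filter (λ j → suc j ≤? suc i) (allFin n)) ⟩
  length (filter (λ j → suc j ≤? suc i) (allFin n))
    ≡⟨ cong length (filter-≐ (λ j → suc j ≤? suc i) (_≤? i) (ℕ.s≤s⁻¹ , ℕ.s≤s) (allFin n)) ⟩
  length (filter (_≤? i) (allFin n))
    ≡⟨ length-filter-≤-allFin i ⟩
  suc (toℕ i) ∎)
  where open ≡-Reasoning

Between : ∀ {n} → Fin n → Fin n → Pred (Fin n) 0ℓ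
Between p i j = p < j × j ≤ i

between? : ∀ {n} (p i : Fin n) → Decidable (Between p i)
between? p i j = (p <? j) ×-dec (j ≤? i)

length-filter-Between-allFin : ∀ {n} {p i : Fin n} → p ≤ i →
  toℕ i ≡ length (filter (between? p i) (allFin n)) ℕ.+ toℕ p
length-filter-Between-allFin {n} {p} {i} p≤i = ℕ.suc-injective (begin
  suc (toℕ i)                              ≡⟨ sym (length-filter-≤-allFin i) ⟩
  length (filter (_≤? i) (allFin n))       ≡⟨ length-filter-∪ (_≤? i) (_≤? p) (between? p i)
                                                 (split , [ (λ j≤p → ℕ.≤-trans j≤p p≤i) , proj₂ ])
                                                 (λ (j≤p , p<j , _) → ℕ.<⇒≱ p<j j≤p) (allFin n) ⟩
  length (filter (_≤? p) (allFin n)) ℕ.+ b ≡⟨ cong (ℕ._+ b) (length-filter-≤-allFin p) ⟩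
  suc (toℕ p) ℕ.+ b                        ≡⟨ cong suc (ℕ.+-comm (toℕ p) b) ⟩
  suc (b ℕ.+ toℕ p)                        ∎)
  where
  open ≡-Reasoning
  b : ℕ
  b = length (filter (between? p i) (allFin n))
  split : ∀ {j} → j ≤ i → j ≤ p ⊎ Between p i j
  split {j} j≤i with j ≤? p
  ... | yes j≤p = inj₁ j≤p
  ... | no j≰p  = inj₂ (ℕ.≰⇒> j≰p , j≤i)

Inversion : ∀ {n} → Perm n → Fin n → Pred (Fin n) 0ℓ
Inversion π i j = i < j × π ⟨ j ⟩ < π ⟨ i ⟩

inversion? : ∀ {n} (π : Perm n) (i : Fin n) → Decidable (Inversion π i)
inversion? π i j = (i <? j) ×-dec (π ⟨ j ⟩ <? π ⟨ i ⟩)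

module _ {n} (π : Perm n) where

  ⟨⟩-injective : ∀ {a b} → π ⟨ a ⟩ ≡ π ⟨ b ⟩ → a ≡ b
  ⟨⟩-injective = Injection.injective (Inverse⇒Injection π)

  IsLmax⇒≤ : ∀ {p l} → IsLmax π p → l ≤ p → π ⟨ l ⟩ ≤ π ⟨ p ⟩
  IsLmax⇒≤ {p} {l} lmax l≤p with l ≟ p
  ... | yes refl = ℕ.≤-refl
  ... | no l≢p   = ℕ.<⇒≤ (lmax l (≤∧≢⇒< l≤p l≢p))

  IsPlmax⇒below : ∀ {i p k} → IsPlmax π i p → p < k → k ≤ i → π ⟨ k ⟩ < π ⟨ p ⟩
  IsPlmax⇒below {i} {p} {k} (lmax , _ , maximal) = go k (<-wellFounded k)
    where
    go : ∀ k → Acc _<_ k → p < k → k ≤ i → π ⟨ k ⟩ < π ⟨ p ⟩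
    go k (acc rec) p<k k≤i with <-cmp (π ⟨ k ⟩) (π ⟨ p ⟩)
    ... | tri< πk<πp _ _ = πk<πp
    ... | tri≈ _ πk≡πp _ = contradiction (⟨⟩-injective πk≡πp) (λ k≡p → ℕ.<⇒≢ p<k (cong toℕ (sym k≡p)))
    ... | tri> _ _ πp<πk = contradiction (maximal k k-lmax k≤i) (ℕ.<⇒≱ p<k)
      where
      k-lmax : IsLmax π k
      k-lmax l l<k with l ≤? p
      ... | yes l≤p = ℕ.≤-<-trans (IsLmax⇒≤ lmax l≤p) πp<πk
      ... | no l≰p  = ℕ.<-trans (go l (rec l<k) (ℕ.≰⇒> l≰p) (ℕ.<⇒≤ (ℕ.<-≤-trans l<k k≤i))) πp<πk

  IsPlmax⇒≤ : ∀ {i p} → IsPlmax π i p → π ⟨ i ⟩ ≤ π ⟨ p ⟩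
  IsPlmax⇒≤ {i} {p} plmax@(_ , p≤i , _) with p ≟ i
  ... | yes refl = ℕ.≤-refl
  ... | no p≢i   = ℕ.<⇒≤ (IsPlmax⇒below plmax (≤∧≢⇒< p≤i p≢i) ℕ.≤-refl)

  Inversion-IsPlmax : ∀ {i p} → Avoids312 π → IsPlmax π i p →
    Inversion π p ≐ Between p i ∪ Inversion π i
  Inversion-IsPlmax {i} {p} avoids plmax@(_ , p≤i , _) = split , [ from-between , from-inversion ]
    where
    split : ∀ {x} → Inversion π p x → (Between p i ∪ Inversion π i) x
    split {x} (p<x , πx<πp) with x ≤? i
    ... | yes x≤i = inj₁ (p<x , x≤i)
    ... | no x≰i with <-cmp (π ⟨ x ⟩) (π ⟨ i ⟩)
    ...   | tri< πx<πi _ _ = inj₂ (ℕ.≰⇒> x≰i , πx<πi)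
    ...   | tri≈ _ πx≡πi _ = contradiction (ℕ.≤-reflexive (cong toℕ (⟨⟩-injective πx≡πi))) x≰i
    ...   | tri> _ _ πi<πx = contradiction (πi<πx , πx<πp) (avoids p i x p<i (ℕ.≰⇒> x≰i))
      where
      p<i : p < i
      p<i = ≤∧≢⇒< p≤i λ { refl → ℕ.<-asym πi<πx πx<πp }
    from-between : ∀ {x} → Between p i x → Inversion π p x
    from-between (p<x , x≤i) = p<x , IsPlmax⇒below plmax p<x x≤i
    from-inversion : ∀ {x} → Inversion π i x → Inversion π p x
    from-inversion (i<x , πx<πi) = ℕ.≤-<-trans p≤i i<x , ℕ.<-≤-trans πx<πi (IsPlmax⇒≤ plmax)

  Between⊥Inversion : ∀ {p i} → Between p i ⊥ Inversion π i
  Between⊥Inversion ((_ , x≤i) , (i<x , _)) = ℕ.<⇒≱ i<x x≤i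

lemma3p22 : (n : ℕ) → n ≥ 1 → (π : Perm n) → Avoids312 π → (i p : Fin n) →
    IsPlmax π i p →
    + inv π i ≡ (+ inv π p) - ((+ toℕ i) - (+ toℕ p))
lemma3p22 n _ π avoids i p plmax@(_ , p≤i , _) = begin
  + inv π i                                           ≡⟨ +a≡+[b+a]-[+[b+c]-+c] b (inv π i) (toℕ p) ⟩
  + (b ℕ.+ inv π i) - (+ (b ℕ.+ toℕ p) - + toℕ p)     ≡⟨ cong₂ (λ x y → + x - (+ y - + toℕ p))
                                                            (sym inv-p) (sym (length-filter-Between-allFin p≤i)) ⟩
  + inv π p - (+ toℕ i - + toℕ p)                     ∎
  where
  open ≡-Reasoning
  b : ℕ
  b = length (filter (between? p i) (allFin n))

  inv-p : inv π p ≡ b ℕ.+ inv π i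
  inv-p = length-filter-∪ (inversion? π p) (between? p i) (inversion? π i)
            (Inversion-IsPlmax π avoids plmax) (Between⊥Inversion π) (allFin n)

  +a≡+[b+a]-[+[b+c]-+c] : ∀ b a c → + a ≡ + (b ℕ.+ a) - (+ (b ℕ.+ c) - + c)
  +a≡+[b+a]-[+[b+c]-+c] b a c rewrite pos-+ b a | pos-+ b c = ring-identity (+ b) (+ a) (+ c)
    where
    ring-identity : ∀ (B A C : ℤ) → A ≡ (B ℤ.+ A) - ((B ℤ.+ C) - C)
    ring-identity = solve-∀
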